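{- Let $f:\mathbb{F}_2^n\to\{ -1,1\}$ be any Boolean function. If there exists $\alpha\in\mathcal{S}$ such that $|O_{\alpha+\beta}|=2$ for all $\beta\in\mathcal{S}\setminus\{\alpha\}$, then $f$ is plateaued.
   Context: For $\alpha\in\mathbb{F}_2^n$ let $\chi_\alpha(x)=(-1)^{\sum_i\alpha_ix_i}$; every $f:\mathbb{F}_2^n\to\mathbb{R}$ is uniquely $f=\sum_\alpha\widehat f(\alpha)\chi_\alpha$. The Fourier support is $\mathcal{S}=\{\alpha:\widehat f(\alpha)\ne0\}$. For $\gamma\in\mathbb{F}_2^n$, $O_\gamma$ is the set of unordered pairs of distinct elements of $\mathcal{S}$ summing to $\gamma$. A Boolean function $f$ is plateaued if there exists $x\in\mathbb{R}$ with $\widehat f(\alpha)\in\{0,x,-x\}$ for all $\alpha\in\mathbb{F}_2^n$. -}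

module Defs where

open import Data.Bool using (Bool; true; false; _xor_; _∧_; if_then_else_)
open import Data.Nat as ℕ using (ℕ; zero; suc; _^_)
open import Data.Nat.Properties using (m^n≢0)
open import Data.Integer as ℤ using (ℤ; +_; -_)
open import Data.Rational as ℚ using (ℚ; 0ℚ)
open import Data.Vec using (Vec; []; _∷_; zipWith)
import Data.Vec.Properties as VecP
import Data.Bool.Properties as BoolP
open import Data.List using (List; []; _∷_; map; _++_; length; filter; foldr)
open import Data.Product using (_×_; _,_; proj₁; proj₂)
open import Relation.Nullary using (¬_; ¬?)
open import Relation.Nullary.Decidable using (_×-dec_)
open import Relation.Binary.PropositionalEquality using (_≡_; _≢_)
open import Data.Sum using (_⊎_)

F₂^ : ℕ → Set
F₂^ n = Vec Bool n

_⊕_ : ∀ {n} → F₂^ n → F₂^ n → F₂^ n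
_⊕_ = zipWith _xor_

_≟v_ : ∀ {n} (u v : F₂^ n) → Relation.Nullary.Dec (u ≡ v)
_≟v_ = VecP.≡-dec BoolP._≟_

allVecs : ∀ n → List (F₂^ n)
allVecs zero    = [] ∷ []
allVecs (suc n) = map (false ∷_) (allVecs n) ++ map (true ∷_) (allVecs n)

dot : ∀ {n} → F₂^ n → F₂^ n → Bool
dot []       []       = false
dot (a ∷ as) (x ∷ xs) = (a ∧ x) xor dot as xs

χ : ∀ {n} → F₂^ n → F₂^ n → ℤ
χ α x = if dot α x then ℤ.-[1+ 0 ] else + 1

sumℤ : List ℤ → ℤ
sumℤ = foldr ℤ._+_ (+ 0)

-- Fourier coefficient  f̂(α) = 2⁻ⁿ Σₓ f(x) χ_α(x)
-- (the unique coefficients with f = Σ_α f̂(α) χ_α)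
fourier : ∀ {n} → (F₂^ n → ℤ) → F₂^ n → ℚ
fourier {n} f α =
  ℚ._/_ (sumℤ (map (λ x → f x ℤ.* χ α x) (allVecs n))) (2 ^ n) {{m^n≢0 2 n}}

InSupp : ∀ {n} → (F₂^ n → ℤ) → F₂^ n → Set
InSupp f α = fourier f α ≢ 0ℚ

unorderedPairs : ∀ {A : Set} → List A → List (A × A)
unorderedPairs []       = []
unorderedPairs (x ∷ xs) = map (x ,_) xs ++ unorderedPairs xs

O : ∀ {n} → (F₂^ n → ℤ) → F₂^ n → List (F₂^ n × F₂^ n)
O {n} f γ = filter P? (unorderedPairs (allVecs n))
  where
  P? : (p : F₂^ n × F₂^ n) → Relation.Nullary.Dec
         ((fourier f (proj₁ p) ≢ 0ℚ) × (fourier f (proj₂ p) ≢ 0ℚ)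
          × (proj₁ p ≢ proj₂ p) × ((proj₁ p ⊕ proj₂ p) ≡ γ))
  P? (a , b) = ¬? (fourier f a ℚ.≟ 0ℚ) ×-dec ¬? (fourier f b ℚ.≟ 0ℚ)
               ×-dec ¬? (a ≟v b) ×-dec ((a ⊕ b) ≟v γ)

|O| : ∀ {n} → (F₂^ n → ℤ) → F₂^ n → ℕ
|O| f γ = length (O f γ)

IsBoolean : ∀ {n} → (F₂^ n → ℤ) → Set
IsBoolean f = ∀ x → f x ≡ + 1 ⊎ f x ≡ ℤ.-[1+ 0 ]

-- plateaued: ∃ x ∈ ℝ with f̂(α) ∈ {0, x, -x} for all α
-- (f̂ takes values in ℚ, so x may be taken in ℚ: if some f̂(α) ≠ 0 then x = ±f̂(α) ∈ ℚ, else x = 0)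
Plateaued : ∀ {n} → (F₂^ n → ℤ) → Set
Plateaued f = Data.Product.∃ λ (x : ℚ) → ∀ α →
  fourier f α ≡ 0ℚ ⊎ fourier f α ≡ x ⊎ fourier f α ≡ ℚ.-_ x

-- Put W(a) = Σₓ f(x) χ_a(x) = 2ⁿ f̂(a). As f² = 1, orthogonality of the characters gives
-- Σ_y W(y) W(y+γ) = 0 for γ ≠ 0, and the nonzero terms of this sum come from the pairs of O_γ;
-- so if O_γ = {{a,b},{c,d}} then W(a)W(b) + W(c)W(d) = 0. For β ∈ 𝒮 \ {α} let {c,d} be the
-- second pair of O_{α+β}. Then {α,c}, {β,d} are the pairs of O_{α+c} and {α,d}, {β,c} those of
-- O_{α+d}, whence W(α)W(c) + W(β)W(d) = 0 = W(α)W(d) + W(β)W(c). Therefore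
-- (W(α)² − W(β)²) W(c) W(d) = 0, and W(β) = ±W(α) because c, d ∈ 𝒮.

module Submission where

open import Defs
open import Algebra.Bundles using (CommutativeRing)
open import Data.Bool using (Bool; true; false; _xor_; _∧_; if_then_else_)
import Data.Bool.Properties as BoolP
open import Algebra.Properties.CommutativeSemigroup
  (CommutativeRing.+-commutativeSemigroup BoolP.xor-∧-commutativeRing) using (interchange)
open import Data.Nat using (ℕ; zero; suc; _^_; NonZero)
import Data.Nat.Properties as ℕP
open import Data.Integer using (ℤ; +_; -_; _+_; _*_; _-_; -[1+_])
import Data.Integer.Properties as ℤP
open import Data.Integer.GCD using (gcd)
open import Data.Integer.Tactic.RingSolver using (solve-∀)
open import Data.Rational as ℚ using (0ℚ)
import Data.Rational.Properties as ℚP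
open import Algebra.Properties.Group ℚP.+-0-group using (⁻¹-involutive)
open import Data.Vec using ([]; _∷_; replicate)
import Data.Vec.Properties as VecP
open import Data.List using (List; []; _∷_; map; _++_; length)
import Data.List.Properties as ListP
open import Data.List.Membership.Propositional using (_∈_; _∉_; lose)
import Data.List.Membership.Propositional.Properties as ∈P
open import Data.List.Relation.Unary.Any using (Any; here; there)
import Data.List.Relation.Unary.All as All
open import Data.List.Relation.Unary.All.Properties using (All¬⇒¬Any)
open import Data.List.Relation.Unary.AllPairs using (AllPairs; []; _∷_)
import Data.List.Relation.Unary.AllPairs as AllPairs
import Data.List.Relation.Unary.AllPairs.Properties as AllPairsP
open import Data.List.Relation.Unary.Unique.Propositional using (Unique)
import Data.List.Relation.Unary.Unique.Propositional.Properties as UniqueP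
open import Data.Product using (Σ; ∃; _×_; _,_; proj₂)
open import Data.Sum using (_⊎_; inj₁; inj₂; [_,_])
open import Data.Empty using (⊥; ⊥-elim)
open import Function using (_∘_)
open import Relation.Nullary using (¬_; ¬?; Dec; yes; no)
open import Relation.Nullary.Decidable using (_×-dec_)
open import Relation.Binary.PropositionalEquality hiding ([_])

0ᵛ : ∀ n → F₂^ n
0ᵛ n = replicate n false

⊕-comm : ∀ {n} (a b : F₂^ n) → a ⊕ b ≡ b ⊕ a
⊕-comm = VecP.zipWith-comm BoolP.xor-comm

⊕-assoc : ∀ {n} (a b c : F₂^ n) → (a ⊕ b) ⊕ c ≡ a ⊕ (b ⊕ c)
⊕-assoc = VecP.zipWith-assoc BoolP.xor-assoc

⊕-identityˡ : ∀ {n} (a : F₂^ n) → 0ᵛ n ⊕ a ≡ a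
⊕-identityˡ = VecP.zipWith-identityˡ BoolP.xor-identityˡ

⊕-identityʳ : ∀ {n} (a : F₂^ n) → a ⊕ 0ᵛ n ≡ a
⊕-identityʳ = VecP.zipWith-identityʳ BoolP.xor-identityʳ

⊕-self : ∀ {n} (a : F₂^ n) → a ⊕ a ≡ 0ᵛ n
⊕-self []      = refl
⊕-self (x ∷ a) = cong₂ _∷_ (BoolP.xor-same x) (⊕-self a)

⊕-cancelˡ : ∀ {n} (a b : F₂^ n) → a ⊕ (a ⊕ b) ≡ b
⊕-cancelˡ a b = begin
  a ⊕ (a ⊕ b) ≡⟨ ⊕-assoc a a b ⟨
  (a ⊕ a) ⊕ b ≡⟨ cong (_⊕ b) (⊕-self a) ⟩
  0ᵛ _ ⊕ b    ≡⟨ ⊕-identityˡ b ⟩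
  b           ∎
  where open ≡-Reasoning

⊕-cancelʳ : ∀ {n} (a b : F₂^ n) → (a ⊕ b) ⊕ b ≡ a
⊕-cancelʳ a b = begin
  (a ⊕ b) ⊕ b ≡⟨ ⊕-assoc a b b ⟩
  a ⊕ (b ⊕ b) ≡⟨ cong (a ⊕_) (⊕-self b) ⟩
  a ⊕ 0ᵛ _    ≡⟨ ⊕-identityʳ a ⟩
  a           ∎
  where open ≡-Reasoning

⊕-injectiveʳ : ∀ {n} {a b c : F₂^ n} → a ⊕ b ≡ a ⊕ c → b ≡ c
⊕-injectiveʳ {a = a} {b} {c} e = begin
  b           ≡⟨ ⊕-cancelˡ a b ⟨
  a ⊕ (a ⊕ b) ≡⟨ cong (a ⊕_) e ⟩
  a ⊕ (a ⊕ c) ≡⟨ ⊕-cancelˡ a c ⟩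
  c           ∎
  where open ≡-Reasoning

⊕-solveʳ : ∀ {n} {a b c : F₂^ n} → a ⊕ b ≡ c → a ⊕ c ≡ b
⊕-solveʳ {a = a} {b} e = trans (cong (a ⊕_) (sym e)) (⊕-cancelˡ a b)

⊕≡0⇒≡ : ∀ {n} {a b : F₂^ n} → a ⊕ b ≡ 0ᵛ n → a ≡ b
⊕≡0⇒≡ {a = a} e = trans (sym (⊕-identityʳ a)) (⊕-solveʳ e)

x≢x⊕y : ∀ {n} {y : F₂^ n} → y ≢ 0ᵛ n → ∀ x → x ≢ x ⊕ y
x≢x⊕y {n} {y} y≢0 x x≡x⊕y = y≢0 (begin
  y           ≡⟨ ⊕-cancelˡ x y ⟨
  x ⊕ (x ⊕ y) ≡⟨ cong (x ⊕_) x≡x⊕y ⟨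
  x ⊕ x       ≡⟨ ⊕-self x ⟩
  0ᵛ n        ∎)
  where open ≡-Reasoning

⊕-interchange-≡ : ∀ {n} {a b c d : F₂^ n} → a ⊕ b ≡ c ⊕ d → a ⊕ c ≡ b ⊕ d
⊕-interchange-≡ {a = a} {b} {c} {d} e = begin
  a ⊕ c             ≡⟨ ⊕-cancelʳ (a ⊕ c) d ⟨
  ((a ⊕ c) ⊕ d) ⊕ d ≡⟨ cong (_⊕ d) (⊕-assoc a c d) ⟩
  (a ⊕ (c ⊕ d)) ⊕ d ≡⟨ cong (_⊕ d) (⊕-solveʳ e) ⟩
  b ⊕ d             ∎
  where open ≡-Reasoning

sgn : Bool → ℤ
sgn b = if b then -[1+ 0 ] else + 1

sgn-xor : ∀ a b → sgn (a xor b) ≡ sgn a * sgn b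
sgn-xor false false = refl
sgn-xor false true  = refl
sgn-xor true  false = refl
sgn-xor true  true  = refl

dot-⊕ˡ : ∀ {n} (a b x : F₂^ n) → dot (a ⊕ b) x ≡ dot a x xor dot b x
dot-⊕ˡ []      []      []      = refl
dot-⊕ˡ (a ∷ as) (b ∷ bs) (x ∷ xs) = begin
  ((a xor b) ∧ x) xor dot (as ⊕ bs) xs
    ≡⟨ cong₂ _xor_ (BoolP.∧-distribʳ-xor x a b) (dot-⊕ˡ as bs xs) ⟩
  ((a ∧ x) xor (b ∧ x)) xor (dot as xs xor dot bs xs)
    ≡⟨ interchange (a ∧ x) (b ∧ x) (dot as xs) (dot bs xs) ⟩
  ((a ∧ x) xor dot as xs) xor ((b ∧ x) xor dot bs xs) ∎
  where open ≡-Reasoning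

dot-comm : ∀ {n} (a x : F₂^ n) → dot a x ≡ dot x a
dot-comm []       []       = refl
dot-comm (a ∷ as) (x ∷ xs) = cong₂ _xor_ (BoolP.∧-comm a x) (dot-comm as xs)

dot-0ʳ : ∀ {n} (a : F₂^ n) → dot a (0ᵛ n) ≡ false
dot-0ʳ []       = refl
dot-0ʳ (a ∷ as) = cong₂ _xor_ (BoolP.∧-zeroʳ a) (dot-0ʳ as)

χ-⊕ˡ : ∀ {n} (a b x : F₂^ n) → χ (a ⊕ b) x ≡ χ a x * χ b x
χ-⊕ˡ a b x = trans (cong sgn (dot-⊕ˡ a b x)) (sgn-xor (dot a x) (dot b x))

χ-comm : ∀ {n} (a x : F₂^ n) → χ a x ≡ χ x a
χ-comm a x = cong sgn (dot-comm a x)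

χ-0ʳ : ∀ {n} (a : F₂^ n) → χ a (0ᵛ n) ≡ + 1
χ-0ʳ a = cong sgn (dot-0ʳ a)

∑ᴸ : {A : Set} → List A → (A → ℤ) → ℤ
∑ᴸ xs g = sumℤ (map g xs)

∑ᴸ-cong : ∀ {A : Set} (xs : List A) {g h : A → ℤ} → (∀ x → g x ≡ h x) → ∑ᴸ xs g ≡ ∑ᴸ xs h
∑ᴸ-cong xs g≗h = cong sumℤ (ListP.map-cong g≗h xs)

∑ᴸ-++ : ∀ {A : Set} (xs ys : List A) (g : A → ℤ) → ∑ᴸ (xs ++ ys) g ≡ ∑ᴸ xs g + ∑ᴸ ys g
∑ᴸ-++ []       ys g = sym (ℤP.+-identityˡ _)
∑ᴸ-++ (x ∷ xs) ys g = trans (cong (_+_ (g x)) (∑ᴸ-++ xs ys g)) (sym (ℤP.+-assoc (g x) _ _))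

∑ᴸ-0 : ∀ {A : Set} (xs : List A) → ∑ᴸ xs (λ _ → + 0) ≡ + 0
∑ᴸ-0 []       = refl
∑ᴸ-0 (x ∷ xs) = trans (ℤP.+-identityˡ _) (∑ᴸ-0 xs)

∑ᴸ-+ : ∀ {A : Set} (xs : List A) (g h : A → ℤ) → ∑ᴸ xs (λ x → g x + h x) ≡ ∑ᴸ xs g + ∑ᴸ xs h
∑ᴸ-+ []       g h = refl
∑ᴸ-+ (x ∷ xs) g h = trans (cong (_+_ (g x + h x)) (∑ᴸ-+ xs g h)) (medial (g x) (h x) _ _)
  where
  medial : ∀ a b c d → (a + b) + (c + d) ≡ (a + c) + (b + d)
  medial = solve-∀

∑ᴸ-*ˡ : ∀ {A : Set} (xs : List A) c (g : A → ℤ) → ∑ᴸ xs (λ x → c * g x) ≡ c * ∑ᴸ xs g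
∑ᴸ-*ˡ []       c g = sym (ℤP.*-zeroʳ c)
∑ᴸ-*ˡ (x ∷ xs) c g =
  trans (cong (_+_ (c * g x)) (∑ᴸ-*ˡ xs c g)) (sym (ℤP.*-distribˡ-+ c (g x) _))

∑ᴸ-*ʳ : ∀ {A : Set} (xs : List A) c (g : A → ℤ) → ∑ᴸ xs (λ x → g x * c) ≡ ∑ᴸ xs g * c
∑ᴸ-*ʳ []       c g = sym (ℤP.*-zeroˡ c)
∑ᴸ-*ʳ (x ∷ xs) c g =
  trans (cong (_+_ (g x * c)) (∑ᴸ-*ʳ xs c g)) (sym (ℤP.*-distribʳ-+ c (g x) _))

∑ᴸ-swap : ∀ {A B : Set} (xs : List A) (ys : List B) (g : A → B → ℤ) →
          ∑ᴸ xs (λ x → ∑ᴸ ys (g x)) ≡ ∑ᴸ ys (λ y → ∑ᴸ xs (λ x → g x y))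
∑ᴸ-swap []       ys g = sym (∑ᴸ-0 ys)
∑ᴸ-swap (x ∷ xs) ys g =
  trans (cong (_+_ (∑ᴸ ys (g x))) (∑ᴸ-swap xs ys g)) (sym (∑ᴸ-+ ys (g x) _))

∑ᴸ-*-∑ᴸ : ∀ {A B : Set} (xs : List A) (ys : List B) (g : A → ℤ) (h : B → ℤ) →
          ∑ᴸ xs g * ∑ᴸ ys h ≡ ∑ᴸ xs (λ x → ∑ᴸ ys (λ y → g x * h y))
∑ᴸ-*-∑ᴸ xs ys g h = trans (sym (∑ᴸ-*ʳ xs (∑ᴸ ys h) g))
  (∑ᴸ-cong xs (λ x → sym (∑ᴸ-*ˡ ys (g x) h)))

∑ : ∀ n → (F₂^ n → ℤ) → ℤ
∑ n = ∑ᴸ (allVecs n)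

∑-suc : ∀ n (g : F₂^ (suc n) → ℤ) →
        ∑ (suc n) g ≡ ∑ n (λ a → g (false ∷ a)) + ∑ n (λ a → g (true ∷ a))
∑-suc n g = begin
  sumℤ (map g (map (false ∷_) A ++ map (true ∷_) A))
    ≡⟨ ∑ᴸ-++ (map (false ∷_) A) (map (true ∷_) A) g ⟩
  sumℤ (map g (map (false ∷_) A)) + sumℤ (map g (map (true ∷_) A))
    ≡⟨ cong₂ _+_ (cong sumℤ (ListP.map-∘ A)) (cong sumℤ (ListP.map-∘ A)) ⟨
  ∑ n (λ a → g (false ∷ a)) + ∑ n (λ a → g (true ∷ a)) ∎
  where
  open ≡-Reasoning
  A = allVecs n

allVecs-complete : ∀ n (x : F₂^ n) → x ∈ allVecs n
allVecs-complete zero    []          = here refl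
allVecs-complete (suc n) (false ∷ x) =
  ∈P.∈-++⁺ˡ (∈P.∈-map⁺ (false ∷_) (allVecs-complete n x))
allVecs-complete (suc n) (true ∷ x)  =
  ∈P.∈-++⁺ʳ (map (false ∷_) (allVecs n)) (∈P.∈-map⁺ (true ∷_) (allVecs-complete n x))

allVecs-unique : ∀ n → Unique (allVecs n)
allVecs-unique zero    = All.[] ∷ []
allVecs-unique (suc n) = UniqueP.++⁺ (UniqueP.map⁺ VecP.∷-injectiveʳ (allVecs-unique n))
  (UniqueP.map⁺ VecP.∷-injectiveʳ (allVecs-unique n)) disjoint
  where
  disjoint : ∀ {v} → v ∈ map (false ∷_) (allVecs n) × v ∈ map (true ∷_) (allVecs n) → ⊥
  disjoint (v∈₀ , v∈₁) with ∈P.∈-map⁻ (false ∷_) v∈₀ | ∈P.∈-map⁻ (true ∷_) v∈₁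
  ... | _ , _ , refl | _ , _ , ()

-- Orthogonality of the characters

δᵇ : Bool → Bool → ℤ
δᵇ false false = + 1
δᵇ false true  = + 0
δᵇ true  false = + 0
δᵇ true  true  = + 1

δ : ∀ {n} → F₂^ n → F₂^ n → ℤ
δ []      []      = + 1
δ (b ∷ x) (c ∷ y) = δᵇ b c * δ x y

δ-refl : ∀ {n} (x : F₂^ n) → δ x x ≡ + 1
δ-refl []          = refl
δ-refl (false ∷ x) = trans (ℤP.*-identityˡ _) (δ-refl x)
δ-refl (true ∷ x)  = trans (ℤP.*-identityˡ _) (δ-refl x)

δ-≢ : ∀ {n} {x y : F₂^ n} → x ≢ y → δ x y ≡ + 0
δ-≢ {x = []}          {[]}          x≢y = ⊥-elim (x≢y refl)
δ-≢ {x = false ∷ x}   {false ∷ y}   x≢y = trans (ℤP.*-identityˡ _) (δ-≢ (x≢y ∘ cong (false ∷_)))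
δ-≢ {x = true ∷ x}    {true ∷ y}    x≢y = trans (ℤP.*-identityˡ _) (δ-≢ (x≢y ∘ cong (true ∷_)))
δ-≢ {x = false ∷ x}   {true ∷ y}    _   = ℤP.*-zeroˡ (δ x y)
δ-≢ {x = true ∷ x}    {false ∷ y}   _   = ℤP.*-zeroˡ (δ x y)

δ-comm : ∀ {n} (x y : F₂^ n) → δ x y ≡ δ y x
δ-comm []      []      = refl
δ-comm (b ∷ x) (c ∷ y) = cong₂ _*_ (δᵇ-comm b c) (δ-comm x y)
  where
  δᵇ-comm : ∀ b c → δᵇ b c ≡ δᵇ c b
  δᵇ-comm false false = refl
  δᵇ-comm false true  = refl
  δᵇ-comm true  false = refl
  δᵇ-comm true  true  = refl

module _ {n : ℕ} (h : F₂^ n → ℤ) where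

  ∑ᴸ-δ-∉ : ∀ {x xs} → x ∉ xs → ∑ᴸ xs (λ y → h y * δ x y) ≡ + 0
  ∑ᴸ-δ-∉ {xs = []}     _   = refl
  ∑ᴸ-δ-∉ {xs = y ∷ ys} x∉ = cong₂ _+_
    (trans (cong (h y *_) (δ-≢ (λ x≡y → x∉ (here x≡y)))) (ℤP.*-zeroʳ (h y)))
    (∑ᴸ-δ-∉ (λ x∈ → x∉ (there x∈)))

  ∑ᴸ-δ-∈ : ∀ {x xs} → Unique xs → x ∈ xs → ∑ᴸ xs (λ y → h y * δ x y) ≡ h x
  ∑ᴸ-δ-∈ {x} (x∉ys ∷ _) (here refl) = begin
    h x * δ x x + _ ≡⟨ cong₂ _+_ (cong (h x *_) (δ-refl x)) (∑ᴸ-δ-∉ (All¬⇒¬Any x∉ys)) ⟩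
    h x * + 1 + + 0 ≡⟨ ℤP.+-identityʳ _ ⟩
    h x * + 1       ≡⟨ ℤP.*-identityʳ (h x) ⟩
    h x             ∎
    where open ≡-Reasoning
  ∑ᴸ-δ-∈ {x} {y ∷ _} (y∉ys ∷ u) (there x∈) = begin
    h y * δ x y + _ ≡⟨ cong₂ _+_ (cong (h y *_) (δ-≢ (λ x≡y → All.lookup y∉ys x∈ (sym x≡y)))) (∑ᴸ-δ-∈ u x∈) ⟩
    h y * + 0 + h x ≡⟨ cong (_+ h x) (ℤP.*-zeroʳ (h y)) ⟩
    + 0 + h x       ≡⟨ ℤP.+-identityˡ (h x) ⟩
    h x             ∎
    where open ≡-Reasoning

∑-δ : ∀ n (h : F₂^ n → ℤ) x → ∑ n (λ y → h y * δ x y) ≡ h x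
∑-δ n h x = ∑ᴸ-δ-∈ h (allVecs-unique n) (allVecs-complete n x)

sgn-δᵇ : ∀ b c → + 1 + sgn b * sgn c ≡ + 2 * δᵇ b c
sgn-δᵇ false false = refl
sgn-δᵇ false true  = refl
sgn-δᵇ true  false = refl
sgn-δᵇ true  true  = refl

orthogonality : ∀ n (x y : F₂^ n) → ∑ n (λ a → χ a x * χ a y) ≡ + (2 ^ n) * δ x y
orthogonality zero    []      []      = refl
orthogonality (suc n) (b ∷ x) (c ∷ y) = begin
  ∑ (suc n) (λ a → χ a (b ∷ x) * χ a (c ∷ y))
    ≡⟨ ∑-suc n _ ⟩
  S + ∑ n (λ a → sgn (b xor dot a x) * sgn (c xor dot a y))
    ≡⟨ cong (_+_ S) (∑ᴸ-cong (allVecs n) λ a →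
         trans (cong₂ _*_ (sgn-xor b (dot a x)) (sgn-xor c (dot a y)))
               (interchange-* (sgn b) (sgn c) (χ a x) (χ a y))) ⟩
  S + ∑ n (λ a → (sgn b * sgn c) * (χ a x * χ a y))
    ≡⟨ cong (_+_ S) (∑ᴸ-*ˡ (allVecs n) (sgn b * sgn c) _) ⟩
  S + (sgn b * sgn c) * S
    ≡⟨ cong (λ t → t + (sgn b * sgn c) * t) (orthogonality n x y) ⟩
  P * D + (sgn b * sgn c) * (P * D)
    ≡⟨ factor (sgn b * sgn c) (P * D) ⟩
  (+ 1 + sgn b * sgn c) * (P * D)
    ≡⟨ cong (_* (P * D)) (sgn-δᵇ b c) ⟩
  (+ 2 * δᵇ b c) * (P * D)
    ≡⟨ regroup (δᵇ b c) P D ⟩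
  (+ 2 * P) * (δᵇ b c * D)
    ≡⟨ cong (_* (δᵇ b c * D)) (ℤP.pos-* 2 (2 ^ n)) ⟨
  + (2 ^ suc n) * δ (b ∷ x) (c ∷ y) ∎
  where
  open ≡-Reasoning
  S = ∑ n (λ a → χ a x * χ a y)
  P = + (2 ^ n)
  D = δ x y
  interchange-* : ∀ p q r s → (p * r) * (q * s) ≡ (p * q) * (r * s)
  interchange-* = solve-∀
  factor : ∀ s t → t + s * t ≡ (+ 1 + s) * t
  factor = solve-∀
  regroup : ∀ d p e → (+ 2 * d) * (p * e) ≡ (+ 2 * p) * (d * e)
  regroup = solve-∀

∑-χ : ∀ n {γ : F₂^ n} → γ ≢ 0ᵛ n → ∑ n (χ γ) ≡ + 0
∑-χ n {γ} γ≢0 = begin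
  ∑ n (χ γ)                               ≡⟨ ∑ᴸ-cong (allVecs n) χγ≡ ⟩
  ∑ n (λ x → χ x γ * χ x (0ᵛ n))          ≡⟨ orthogonality n γ (0ᵛ n) ⟩
  + (2 ^ n) * δ γ (0ᵛ n)                  ≡⟨ cong (_*_ (+ (2 ^ n))) (δ-≢ γ≢0) ⟩
  + (2 ^ n) * + 0                         ≡⟨ ℤP.*-zeroʳ (+ (2 ^ n)) ⟩
  + 0                                     ∎
  where
  open ≡-Reasoning
  χγ≡ : ∀ x → χ γ x ≡ χ x γ * χ x (0ᵛ n)
  χγ≡ x = sym (trans (cong (_*_ (χ x γ)) (χ-0ʳ x)) (trans (ℤP.*-identityʳ _) (χ-comm x γ)))

∑-supported : ∀ {n} {g : F₂^ n → ℤ} (ps : List (F₂^ n)) → Unique ps →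
              (∀ y → y ∉ ps → g y ≡ + 0) → ∑ n g ≡ ∑ᴸ ps g
∑-supported {n} {g} ps ps-unique vanish = begin
  ∑ n g                                   ≡⟨ ∑ᴸ-cong (allVecs n) sift ⟩
  ∑ n (λ y → ∑ᴸ ps (λ p → g p * δ y p))   ≡⟨ ∑ᴸ-swap (allVecs n) ps _ ⟩
  ∑ᴸ ps (λ p → ∑ n (λ y → g p * δ y p))   ≡⟨ ∑ᴸ-cong ps (λ p → trans
                                               (∑ᴸ-cong (allVecs n) (λ y → cong (_*_ (g p)) (δ-comm y p)))
                                               (∑-δ n (λ _ → g p) p)) ⟩
  ∑ᴸ ps g                                 ∎
  where
  open ≡-Reasoning
  open import Data.List.Membership.DecPropositional (_≟v_ {n}) using (_∈?_)
  sift : ∀ y → g y ≡ ∑ᴸ ps (λ p → g p * δ y p)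
  sift y with y ∈? ps
  ... | yes y∈ = sym (∑ᴸ-δ-∈ g ps-unique y∈)
  ... | no  y∉ = trans (vanish y y∉) (sym (∑ᴸ-δ-∉ g y∉))

walsh : ∀ {n} → (F₂^ n → ℤ) → F₂^ n → ℤ
walsh {n} f a = ∑ n (λ x → f x * χ a x)

autocorrelation : ∀ {n} (f : F₂^ n → ℤ) (γ : F₂^ n) →
  ∑ n (λ a → walsh f a * walsh f (a ⊕ γ)) ≡ + (2 ^ n) * ∑ n (λ x → f x * f x * χ γ x)
autocorrelation {n} f γ = begin
  ∑ n (λ a → walsh f a * walsh f (a ⊕ γ))
    ≡⟨ ∑ᴸ-cong V (λ a → ∑ᴸ-*-∑ᴸ V V _ _) ⟩
  ∑ n (λ a → ∑ n (λ x → ∑ n (λ y → (f x * χ a x) * (f y * χ (a ⊕ γ) y))))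
    ≡⟨ ∑ᴸ-cong V (λ a → ∑ᴸ-cong V (λ x → ∑ᴸ-cong V (λ y →
         trans (cong (λ t → (f x * χ a x) * (f y * t)) (χ-⊕ˡ a γ y))
               (regroup (f x) (χ a x) (f y) (χ a y) (χ γ y))))) ⟩
  ∑ n (λ a → ∑ n (λ x → ∑ n (λ y → T x y * (χ a x * χ a y))))
    ≡⟨ ∑ᴸ-swap V V _ ⟩
  ∑ n (λ x → ∑ n (λ a → ∑ n (λ y → T x y * (χ a x * χ a y))))
    ≡⟨ ∑ᴸ-cong V (λ x → ∑ᴸ-swap V V _) ⟩
  ∑ n (λ x → ∑ n (λ y → ∑ n (λ a → T x y * (χ a x * χ a y))))
    ≡⟨ ∑ᴸ-cong V (λ x → ∑ᴸ-cong V (λ y →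
         trans (∑ᴸ-*ˡ V (T x y) _) (cong (_*_ (T x y)) (orthogonality n x y)))) ⟩
  ∑ n (λ x → ∑ n (λ y → T x y * (P * δ x y)))
    ≡⟨ ∑ᴸ-cong V (λ x → trans (∑ᴸ-cong V (λ y → sym (ℤP.*-assoc (T x y) P (δ x y))))
                              (∑-δ n (λ y → T x y * P) x)) ⟩
  ∑ n (λ x → T x x * P)
    ≡⟨ ∑ᴸ-*ʳ V P (λ x → T x x) ⟩
  ∑ n (λ x → T x x) * P
    ≡⟨ ℤP.*-comm _ P ⟩
  P * ∑ n (λ x → f x * f x * χ γ x) ∎
  where
  open ≡-Reasoning
  V = allVecs n
  P = + (2 ^ n)
  T : F₂^ n → F₂^ n → ℤ
  T x y = f x * f y * χ γ y
  regroup : ∀ fx cx fy cy gy → (fx * cx) * (fy * (cy * gy)) ≡ (fx * fy * gy) * (cx * cy)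
  regroup = solve-∀

boolean-square : ∀ {n} {f : F₂^ n → ℤ} → IsBoolean f → ∀ x → f x * f x ≡ + 1
boolean-square {f = f} f±1 x with f x | f±1 x
... | _ | inj₁ refl = refl
... | _ | inj₂ refl = refl

autocorrelation-boolean : ∀ {n} {f : F₂^ n → ℤ} → IsBoolean f → ∀ {γ} → γ ≢ 0ᵛ n →
  ∑ n (λ a → walsh f a * walsh f (a ⊕ γ)) ≡ + 0
autocorrelation-boolean {n} {f} f±1 {γ} γ≢0 = begin
  ∑ n (λ a → walsh f a * walsh f (a ⊕ γ))  ≡⟨ autocorrelation f γ ⟩
  + (2 ^ n) * ∑ n (λ x → f x * f x * χ γ x) ≡⟨ cong (_*_ (+ (2 ^ n))) (∑ᴸ-cong (allVecs n) λ x →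
                                               trans (cong (_* χ γ x) (boolean-square f±1 x)) (ℤP.*-identityˡ _)) ⟩
  + (2 ^ n) * ∑ n (χ γ)                     ≡⟨ cong (_*_ (+ (2 ^ n))) (∑-χ n γ≢0) ⟩
  + (2 ^ n) * + 0                           ≡⟨ ℤP.*-zeroʳ (+ (2 ^ n)) ⟩
  + 0                                       ∎
  where open ≡-Reasoning

-- Unordered pairs

_≈ᵤ_ : {A : Set} → A × A → A × A → Set
(a , b) ≈ᵤ (c , d) = (a ≡ c × b ≡ d) ⊎ (a ≡ d × b ≡ c)

_≉ᵤ_ : {A : Set} → A × A → A × A → Set
p ≉ᵤ q = ¬ p ≈ᵤ q

_∈ᵤ_ : {A : Set} → A × A → List (A × A) → Set
p ∈ᵤ ps = Any (p ≈ᵤ_) ps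

module _ {A : Set} where

  ≈ᵤ-refl : {p : A × A} → p ≈ᵤ p
  ≈ᵤ-refl = inj₁ (refl , refl)

  ≈ᵤ-swap : {a b : A} → (a , b) ≈ᵤ (b , a)
  ≈ᵤ-swap = inj₂ (refl , refl)

  ≈ᵤ-sym : {p q : A × A} → p ≈ᵤ q → q ≈ᵤ p
  ≈ᵤ-sym (inj₁ (e₁ , e₂)) = inj₁ (sym e₁ , sym e₂)
  ≈ᵤ-sym (inj₂ (e₁ , e₂)) = inj₂ (sym e₂ , sym e₁)

  ≈ᵤ-trans : {p q r : A × A} → p ≈ᵤ q → q ≈ᵤ r → p ≈ᵤ r
  ≈ᵤ-trans (inj₁ (a , b)) (inj₁ (c , d)) = inj₁ (trans a c , trans b d)
  ≈ᵤ-trans (inj₁ (a , b)) (inj₂ (c , d)) = inj₂ (trans a c , trans b d)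
  ≈ᵤ-trans (inj₂ (a , b)) (inj₁ (c , d)) = inj₂ (trans a d , trans b c)
  ≈ᵤ-trans (inj₂ (a , b)) (inj₂ (c , d)) = inj₁ (trans a d , trans b c)

  ∈-unorderedPairs⁻ : ∀ (xs : List A) {a b} → (a , b) ∈ unorderedPairs xs → a ∈ xs × b ∈ xs
  ∈-unorderedPairs⁻ (x ∷ xs) p∈ with ∈P.∈-++⁻ (map (x ,_) xs) p∈
  ... | inj₁ p∈₁ with ∈P.∈-map⁻ (x ,_) p∈₁
  ...   | _ , b∈ , refl = here refl , there b∈
  ∈-unorderedPairs⁻ (x ∷ xs) p∈ | inj₂ p∈₂ with ∈-unorderedPairs⁻ xs p∈₂
  ...   | a∈ , b∈ = there a∈ , there b∈

  ∈-unorderedPairs⁺ : ∀ {xs : List A} {a b} → a ∈ xs → b ∈ xs → a ≢ b →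
                      (a , b) ∈ unorderedPairs xs ⊎ (b , a) ∈ unorderedPairs xs
  ∈-unorderedPairs⁺ (here refl) (here refl) a≢b = ⊥-elim (a≢b refl)
  ∈-unorderedPairs⁺ {x ∷ xs} (here refl) (there b∈) _ = inj₁ (∈P.∈-++⁺ˡ (∈P.∈-map⁺ (x ,_) b∈))
  ∈-unorderedPairs⁺ {x ∷ xs} (there a∈) (here refl) _ = inj₂ (∈P.∈-++⁺ˡ (∈P.∈-map⁺ (x ,_) a∈))
  ∈-unorderedPairs⁺ {x ∷ xs} (there a∈) (there b∈) a≢b with ∈-unorderedPairs⁺ a∈ b∈ a≢b
  ... | inj₁ p∈ = inj₁ (∈P.∈-++⁺ʳ (map (x ,_) xs) p∈)
  ... | inj₂ p∈ = inj₂ (∈P.∈-++⁺ʳ (map (x ,_) xs) p∈)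

  unorderedPairs-≉ᵤ : ∀ {xs : List A} → Unique xs → AllPairs _≉ᵤ_ (unorderedPairs xs)
  unorderedPairs-≉ᵤ {[]}     _           = []
  unorderedPairs-≉ᵤ {x ∷ xs} (x∉xs ∷ u) = AllPairsP.++⁺
    (AllPairsP.map⁺ (AllPairs.map same-head u))
    (unorderedPairs-≉ᵤ u)
    (All.tabulate λ p∈ → All.tabulate λ q∈ → head≉tail p∈ q∈)
    where
    same-head : ∀ {y z} → y ≢ z → (x , y) ≉ᵤ (x , z)
    same-head y≢z (inj₁ (_ , y≡z))     = y≢z y≡z
    same-head y≢z (inj₂ (x≡z , y≡x)) = y≢z (trans y≡x x≡z)
    head≉tail : ∀ {p q} → p ∈ map (x ,_) xs → q ∈ unorderedPairs xs → p ≉ᵤ q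
    head≉tail p∈ q∈ p≈q with ∈P.∈-map⁻ (x ,_) p∈ | ∈-unorderedPairs⁻ xs q∈ | p≈q
    ... | _ , _ , refl | c∈ , _ | inj₁ (x≡c , _) = All.lookup x∉xs c∈ x≡c
    ... | _ , _ , refl | _ , d∈ | inj₂ (x≡d , _) = All.lookup x∉xs d∈ x≡d

  ∈ᵤ-pair : ∀ {p q x : A × A} → x ∈ᵤ (p ∷ q ∷ []) → x ≈ᵤ p ⊎ x ≈ᵤ q
  ∈ᵤ-pair (here x≈p)         = inj₁ x≈p
  ∈ᵤ-pair (there (here x≈q)) = inj₂ x≈q

  ∈ᵤ-length2-other : ∀ {ps : List (A × A)} {x} → length ps ≡ 2 → AllPairs _≉ᵤ_ ps →
                     x ∈ᵤ ps → ∃ λ y → y ∈ ps × x ≉ᵤ y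
  ∈ᵤ-length2-other {p ∷ q ∷ []} refl ((p≉q All.∷ All.[]) ∷ _) x∈ with ∈ᵤ-pair x∈
  ... | inj₁ x≈p = q , there (here refl) , λ x≈q → p≉q (≈ᵤ-trans (≈ᵤ-sym x≈p) x≈q)
  ... | inj₂ x≈q = p , here refl         , λ x≈p → p≉q (≈ᵤ-trans (≈ᵤ-sym x≈p) x≈q)

  ∈ᵤ-length2-dichotomy : ∀ {ps : List (A × A)} {x y z} → length ps ≡ 2 →
                         x ∈ᵤ ps → y ∈ᵤ ps → x ≉ᵤ y → z ∈ᵤ ps → z ≈ᵤ x ⊎ z ≈ᵤ y
  ∈ᵤ-length2-dichotomy {p ∷ q ∷ []} refl x∈ y∈ x≉y z∈
    with ∈ᵤ-pair x∈ | ∈ᵤ-pair y∈ | ∈ᵤ-pair z∈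
  ... | inj₁ x≈p | inj₁ y≈p | _        = ⊥-elim (x≉y (≈ᵤ-trans x≈p (≈ᵤ-sym y≈p)))
  ... | inj₂ x≈q | inj₂ y≈q | _        = ⊥-elim (x≉y (≈ᵤ-trans x≈q (≈ᵤ-sym y≈q)))
  ... | inj₁ x≈p | inj₂ _   | inj₁ z≈p = inj₁ (≈ᵤ-trans z≈p (≈ᵤ-sym x≈p))
  ... | inj₁ _   | inj₂ y≈q | inj₂ z≈q = inj₂ (≈ᵤ-trans z≈q (≈ᵤ-sym y≈q))
  ... | inj₂ _   | inj₁ y≈p | inj₁ z≈p = inj₂ (≈ᵤ-trans z≈p (≈ᵤ-sym y≈p))
  ... | inj₂ x≈q | inj₁ _   | inj₂ z≈q = inj₁ (≈ᵤ-trans z≈q (≈ᵤ-sym x≈q))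

≉ᵤ⇒disjoint : ∀ {n} {a b c d : F₂^ n} → a ⊕ b ≡ c ⊕ d → (a , b) ≉ᵤ (c , d) →
              a ≢ c × a ≢ d × b ≢ c × b ≢ d
≉ᵤ⇒disjoint {a = a} {b} {c} {d} e ab≉cd =
    (λ a≡c → ab≉cd (inj₁ (a≡c , cancel e a≡c)))
  , (λ a≡d → ab≉cd (inj₂ (a≡d , cancel (trans e (⊕-comm c d)) a≡d)))
  , (λ b≡c → ab≉cd (inj₂ (cancel (trans (⊕-comm b a) e) b≡c , b≡c)))
  , (λ b≡d → ab≉cd (inj₁ (cancel (trans (⊕-comm b a) (trans e (⊕-comm c d))) b≡d , b≡d)))
  where
  cancel : ∀ {x y x′ y′} → x ⊕ y ≡ x′ ⊕ y′ → x ≡ x′ → y ≡ y′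
  cancel e′ refl = ⊕-injectiveʳ e′

-- The sets O_γ

module _ {n : ℕ} (f : F₂^ n → ℤ) where

  IsPair : F₂^ n → F₂^ n × F₂^ n → Set
  IsPair γ (a , b) = InSupp f a × InSupp f b × a ≢ b × a ⊕ b ≡ γ

  -- Literally the decision procedure that filters O f γ, so that the filter lemmas apply to O.
  isPair? : ∀ γ p → Dec (IsPair γ p)
  isPair? γ (a , b) = ¬? (fourier f a ℚ.≟ 0ℚ) ×-dec ¬? (fourier f b ℚ.≟ 0ℚ)
                      ×-dec ¬? (a ≟v b) ×-dec ((a ⊕ b) ≟v γ)

  IsPair-swap : ∀ {γ a b} → IsPair γ (a , b) → IsPair γ (b , a)
  IsPair-swap {a = a} {b} (a∈S , b∈S , a≢b , a⊕b≡γ) =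
    b∈S , a∈S , (λ b≡a → a≢b (sym b≡a)) , trans (⊕-comm b a) a⊕b≡γ

  IsPair-partner : ∀ {γ a b} → IsPair γ (a , b) → a ⊕ γ ≡ b
  IsPair-partner (_ , _ , _ , a⊕b≡γ) = ⊕-solveʳ a⊕b≡γ

  O-sound : ∀ {γ p} → p ∈ O f γ → IsPair γ p
  O-sound {γ} p∈ = proj₂ (∈P.∈-filter⁻ (isPair? γ) {xs = unorderedPairs (allVecs n)} p∈)

  O-complete : ∀ {γ a b} → IsPair γ (a , b) → (a , b) ∈ᵤ O f γ
  O-complete {γ} {a} {b} ab@(_ , _ , a≢b , _)
    with ∈-unorderedPairs⁺ (allVecs-complete n a) (allVecs-complete n b) a≢b
  ... | inj₁ ab∈ = lose (∈P.∈-filter⁺ (isPair? γ) ab∈ ab) ≈ᵤ-refl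
  ... | inj₂ ba∈ = lose (∈P.∈-filter⁺ (isPair? γ) ba∈ (IsPair-swap ab)) ≈ᵤ-swap

  O-≉ᵤ : ∀ γ → AllPairs _≉ᵤ_ (O f γ)
  O-≉ᵤ γ = AllPairsP.filter⁺ (isPair? γ) (unorderedPairs-≉ᵤ (allVecs-unique n))

  O₂-other : ∀ {γ a b} → |O| f γ ≡ 2 → IsPair γ (a , b) → ∃ λ q → IsPair γ q × (a , b) ≉ᵤ q
  O₂-other {γ} |O|≡2 ab with ∈ᵤ-length2-other |O|≡2 (O-≉ᵤ γ) (O-complete ab)
  ... | q , q∈ , ab≉q = q , O-sound q∈ , ab≉q

  O₂-dichotomy : ∀ {γ a b c d u v} → |O| f γ ≡ 2 →
                 IsPair γ (a , b) → IsPair γ (c , d) → (a , b) ≉ᵤ (c , d) → IsPair γ (u , v) →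
                 (u , v) ≈ᵤ (a , b) ⊎ (u , v) ≈ᵤ (c , d)
  O₂-dichotomy |O|≡2 ab cd ab≉cd uv =
    ∈ᵤ-length2-dichotomy |O|≡2 (O-complete ab) (O-complete cd) ab≉cd (O-complete uv)

/≡0⇒≡0 : ∀ i d .{{_ : NonZero d}} → i ℚ./ d ≡ 0ℚ → i ≡ + 0
/≡0⇒≡0 i d i/d≡0 = begin
  i                                     ≡⟨ ℚP.↥-/ i d ⟨
  ℚ.↥ (i ℚ./ d) * gcd i (+ d)           ≡⟨ cong (_* gcd i (+ d)) (ℚP.p≡0⇒↥p≡0 _ i/d≡0) ⟩
  + 0 * gcd i (+ d)                     ≡⟨ ℤP.*-zeroˡ (gcd i (+ d)) ⟩
  + 0                                   ∎
  where open ≡-Reasoning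

neg-/ : ∀ i d .{{_ : NonZero d}} → (- i) ℚ./ d ≡ ℚ.- (i ℚ./ d)
neg-/ (+ zero)  d = trans (ℚP.0/n≡0 d) (cong ℚ.-_ (sym (ℚP.0/n≡0 d)))
neg-/ (+ suc m) d = refl
neg-/ -[1+ m ]  d = sym (⁻¹-involutive _)

sq≡sq⇒≡± : ∀ a b → a * a ≡ b * b → b ≡ a ⊎ b ≡ - a
sq≡sq⇒≡± a b a²≡b² with ℤP.i*j≡0⇒i≡0∨j≡0 (a - b) (trans (difference-of-squares a b) (ℤP.i≡j⇒i-j≡0 a²≡b²))
  where
  difference-of-squares : ∀ a b → (a - b) * (a + b) ≡ a * a - b * b
  difference-of-squares = solve-∀
... | inj₁ a-b≡0 = inj₁ (sym (ℤP.i-j≡0⇒i≡j a b a-b≡0))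
... | inj₂ a+b≡0 = inj₂ (trans (b≡[a+b]-a a b) (trans (cong (_- a) a+b≡0) (ℤP.+-identityˡ (- a))))
  where
  b≡[a+b]-a : ∀ a b → b ≡ (a + b) - a
  b≡[a+b]-a = solve-∀

cross-cancel⇒≡± : ∀ a b c d → c ≢ + 0 → d ≢ + 0 →
                  a * c + b * d ≡ + 0 → a * d + b * c ≡ + 0 → b ≡ a ⊎ b ≡ - a
cross-cancel⇒≡± a b c d c≢0 d≢0 e₁ e₂ with ℤP.i*j≡0⇒i≡0∨j≡0 (a * a - b * b) [a²-b²]cd≡0
  where
  identity : ∀ a b c d → (a * a - b * b) * (c * d) ≡ (a * c + b * d) * (a * d) - (a * d + b * c) * (b * d)
  identity = solve-∀
  [a²-b²]cd≡0 : (a * a - b * b) * (c * d) ≡ + 0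
  [a²-b²]cd≡0 = begin
    (a * a - b * b) * (c * d)                           ≡⟨ identity a b c d ⟩
    (a * c + b * d) * (a * d) - (a * d + b * c) * (b * d) ≡⟨ cong₂ (λ u v → u * (a * d) - v * (b * d)) e₁ e₂ ⟩
    + 0 * (a * d) - + 0 * (b * d)                         ≡⟨ cong₂ _-_ (ℤP.*-zeroˡ (a * d)) (ℤP.*-zeroˡ (b * d)) ⟩
    + 0                                                   ∎
    where open ≡-Reasoning
... | inj₁ a²-b²≡0 = sq≡sq⇒≡± a b (ℤP.i-j≡0⇒i≡j _ _ a²-b²≡0)
... | inj₂ cd≡0    = ⊥-elim ([ c≢0 , d≢0 ] (ℤP.i*j≡0⇒i≡0∨j≡0 c cd≡0))

module _ {n : ℕ} {f : F₂^ n → ℤ} where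

  InSupp⇒walsh≢0 : ∀ a → InSupp f a → walsh f a ≢ + 0
  InSupp⇒walsh≢0 a a∈S walsh≡0 = a∈S (trans (cong (λ w → (w ℚ./ 2 ^ n) {{ℕP.m^n≢0 2 n}}) walsh≡0)
                                           (ℚP.0/n≡0 (2 ^ n) {{ℕP.m^n≢0 2 n}}))

  walsh≢0⇒InSupp : ∀ a → walsh f a ≢ + 0 → InSupp f a
  walsh≢0⇒InSupp a walsh≢0 fourier≡0 = walsh≢0 (/≡0⇒≡0 (walsh f a) (2 ^ n) {{ℕP.m^n≢0 2 n}} fourier≡0)

  walsh-pairs-cancel : IsBoolean f → ∀ {γ a b c d} → γ ≢ 0ᵛ n → |O| f γ ≡ 2 →
                       IsPair f γ (a , b) → IsPair f γ (c , d) → (a , b) ≉ᵤ (c , d) →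
                       walsh f a * walsh f b + walsh f c * walsh f d ≡ + 0
  walsh-pairs-cancel f±1 {γ} {a} {b} {c} {d} γ≢0 |O|≡2
                     ab@(_ , _ , a≢b , a⊕b≡γ) cd@(_ , _ , c≢d , c⊕d≡γ) ab≉cd =
    ℤP.*-cancelˡ-≡ (+ 2) _ (+ 0) (begin
      + 2 * (W a * W b + W c * W d)                               ≡⟨ double (W a) (W b) (W c) (W d) ⟩
      W a * W b + (W b * W a + (W c * W d + (W d * W c + + 0))) ≡⟨ partners ⟨
      ∑ᴸ (a ∷ b ∷ c ∷ d ∷ []) g                                   ≡⟨ ∑-supported _ abcd-unique vanish ⟨
      ∑ n g                                                       ≡⟨ autocorrelation-boolean f±1 γ≢0 ⟩
      + 0                                                         ∎)
    where
    open ≡-Reasoning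
    W = walsh f
    g : F₂^ n → ℤ
    g y = W y * W (y ⊕ γ)
    double : ∀ p q r s → + 2 * (p * q + r * s) ≡ p * q + (q * p + (r * s + (s * r + + 0)))
    double = solve-∀
    partner-term : ∀ {x y} → IsPair f γ (x , y) → g x ≡ W x * W y
    partner-term {x} xy = cong (λ z → W x * W z) (IsPair-partner f xy)
    partners : ∑ᴸ (a ∷ b ∷ c ∷ d ∷ []) g ≡ W a * W b + (W b * W a + (W c * W d + (W d * W c + + 0)))
    partners = cong₂ _+_ (partner-term ab) (cong₂ _+_ (partner-term (IsPair-swap f ab))
                 (cong₂ _+_ (partner-term cd) (cong₂ _+_ (partner-term (IsPair-swap f cd)) refl)))
    abcd-unique : Unique (a ∷ b ∷ c ∷ d ∷ [])
    abcd-unique with ≉ᵤ⇒disjoint (trans a⊕b≡γ (sym c⊕d≡γ)) ab≉cd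
    ... | a≢c , a≢d , b≢c , b≢d =
      (a≢b All.∷ a≢c All.∷ a≢d All.∷ All.[]) ∷ (b≢c All.∷ b≢d All.∷ All.[]) ∷ (c≢d All.∷ All.[]) ∷ All.[] ∷ []
    vanish : ∀ y → y ∉ (a ∷ b ∷ c ∷ d ∷ []) → g y ≡ + 0
    vanish y y∉ with W y ℤP.≟ + 0 | W (y ⊕ γ) ℤP.≟ + 0
    ... | yes Wy≡0 | _    = trans (cong (_* W (y ⊕ γ)) Wy≡0) (ℤP.*-zeroˡ (W (y ⊕ γ)))
    ... | no _ | yes Wy′≡0 = trans (cong (_*_ (W y)) Wy′≡0) (ℤP.*-zeroʳ (W y))
    ... | no Wy≢0 | no Wy′≢0
      with O₂-dichotomy f |O|≡2 ab cd ab≉cd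
             (walsh≢0⇒InSupp y Wy≢0 , walsh≢0⇒InSupp (y ⊕ γ) Wy′≢0 , x≢x⊕y γ≢0 y , ⊕-cancelˡ y γ)
    ... | inj₁ (inj₁ (y≡a , _)) = ⊥-elim (y∉ (here y≡a))
    ... | inj₁ (inj₂ (y≡b , _)) = ⊥-elim (y∉ (there (here y≡b)))
    ... | inj₂ (inj₁ (y≡c , _)) = ⊥-elim (y∉ (there (there (here y≡c))))
    ... | inj₂ (inj₂ (y≡d , _)) = ⊥-elim (y∉ (there (there (there (here y≡d)))))

  pivot⇒walsh-≡± : IsBoolean f → ∀ {α} → InSupp f α →
                   (∀ β → InSupp f β → β ≢ α → |O| f (α ⊕ β) ≡ 2) →
                   ∀ {β} → InSupp f β → β ≢ α → walsh f β ≡ walsh f α ⊎ walsh f β ≡ - walsh f α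
  pivot⇒walsh-≡± f±1 {α} α∈S |O|≡2 {β} β∈S β≢α
    with O₂-other f (|O|≡2 β β∈S β≢α) (α∈S , β∈S , (λ α≡β → β≢α (sym α≡β)) , refl)
  ... | (c , d) , (c∈S , d∈S , _ , c⊕d≡α⊕β) , αβ≉cd
    with ≉ᵤ⇒disjoint (sym c⊕d≡α⊕β) αβ≉cd
  ... | α≢c , α≢d , β≢c , β≢d =
    cross-cancel⇒≡± (W α) (W β) (W c) (W d) (InSupp⇒walsh≢0 c c∈S) (InSupp⇒walsh≢0 d d∈S)
      (walsh-pairs-cancel f±1 (α≢c ∘ ⊕≡0⇒≡) (|O|≡2 c c∈S (α≢c ∘ sym))
        (α∈S , c∈S , α≢c , refl)
        (β∈S , d∈S , β≢d , sym (⊕-interchange-≡ (sym c⊕d≡α⊕β)))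
        λ { (inj₁ (α≡β , _)) → β≢α (sym α≡β) ; (inj₂ (α≡d , _)) → α≢d α≡d })
      (walsh-pairs-cancel f±1 (α≢d ∘ ⊕≡0⇒≡) (|O|≡2 d d∈S (α≢d ∘ sym))
        (α∈S , d∈S , α≢d , refl)
        (β∈S , c∈S , β≢c , sym (⊕-interchange-≡ (trans (sym c⊕d≡α⊕β) (⊕-comm c d))))
        λ { (inj₁ (α≡β , _)) → β≢α (sym α≡β) ; (inj₂ (α≡c , _)) → α≢c α≡c })
    where W = walsh f

claim4 : (n : ℕ) (f : F₂^ n → ℤ) → IsBoolean f →
    Σ (F₂^ n) (λ α → InSupp f α × (∀ β → InSupp f β → β ≢ α → |O| f (α ⊕ β) ≡ 2)) →
    Plateaued f
claim4 n f f±1 (α , α∈S , |O|≡2) = fourier f α , classify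
  where
  to-fourier : ∀ β → walsh f β ≡ walsh f α ⊎ walsh f β ≡ - walsh f α →
               fourier f β ≡ fourier f α ⊎ fourier f β ≡ ℚ.- fourier f α
  to-fourier β (inj₁ e) = inj₁ (cong (λ w → (w ℚ./ 2 ^ n) {{ℕP.m^n≢0 2 n}}) e)
  to-fourier β (inj₂ e) = inj₂ (trans (cong (λ w → (w ℚ./ 2 ^ n) {{ℕP.m^n≢0 2 n}}) e)
                                    (neg-/ (walsh f α) (2 ^ n) {{ℕP.m^n≢0 2 n}}))
  classify : ∀ β → fourier f β ≡ 0ℚ ⊎ fourier f β ≡ fourier f α ⊎ fourier f β ≡ ℚ.- fourier f α
  classify β with fourier f β ℚ.≟ 0ℚ | β ≟v α
  ... | yes β∉S | _        = inj₁ β∉S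
  ... | no _    | yes refl = inj₂ (inj₁ refl)
  ... | no β∈S  | no β≢α   = inj₂ (to-fourier β (pivot⇒walsh-≡± f±1 {α} α∈S |O|≡2 {β} β∈S β≢α))
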